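{- Let $\mathbf{A}$ be a set (of actions) and let $Traces$ be the set of pairs $B=(A,T)$ with $A\subseteq\mathbf{A}$ and $T\subseteq A^*$ a prefix-closed set of words (so $\varepsilon\in T$). For $B_1=(A_1,T_1)$, $B_2=(A_2,T_2)$ define $B_1\parallel B_2=(A_1\cup A_2,T)$ where $$T=\Big\{w=(w_i)_{i=1}^n\in (A_1\cup A_2)^* \;\Big|\; \exists I\subseteq[1,n]:\ (w_i)_{i\in I}\in T_1\ \land\ (w_i)_{i\notin I}\in T_2\Big\}.$$ For words $v,w$ write $v\propto w$ iff $v=(w_i)_{i\in I}$ for some $I\subseteq[1,|w|]$, and for an alphabet $A$ and a language $T$ put $\overline{T}^{A}=\{v\in A^*\mid \exists w\in T:\ v\propto w\}$. Define $B_1\preccurlyeq B_2$ iff $A_1\subseteq A_2$ and $T_1\subseteq \overline{T_2}^{A_1}$. Then $\parallel$ preserves $\preccurlyeq$: for all $B_1,B_2,B_3\in Traces$, $B_2\preccurlyeq B_3$ implies $B_1\parallel B_2\preccurlyeq B_1\parallel B_3$.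
   Context: $(w_i)_{i\in I}$ denotes the subsequence of $w$ consisting of the letters at positions in $I$, in their original order; $|w|$ is the length of $w$. -}

module Defs where

open import Level using (0ℓ)
open import Data.Bool using (Bool; true; false; not; if_then_else_)
open import Data.Fin using (Fin; zero; suc)
open import Data.List using (List; []; _∷_; _++_; length)
open import Data.List.Relation.Unary.All using (All)
open import Data.Product using (Σ; ∃; _×_; _,_)
open import Function using (_∘_)
open import Relation.Unary using (Pred; _∈_; _⊆_; _∪_)
open import Relation.Binary.PropositionalEquality using (_≡_)

module _ {𝐀 : Set} where

  -- (w_i)_{i ∈ I}: the subsequence of w at the positions in I ⊆ [1,|w|],
  -- where I is given by its indicator function on positions Fin |w|.
  select : (w : List 𝐀) → (Fin (length w) → Bool) → List 𝐀
  select []      I = []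
  select (x ∷ w) I = if I zero then x ∷ select w (I ∘ suc) else select w (I ∘ suc)

  _∝_ : List 𝐀 → List 𝐀 → Set
  v ∝ w = Σ (Fin (length w) → Bool) λ I → v ≡ select w I

  Word : Pred 𝐀 0ℓ → Pred (List 𝐀) 0ℓ
  Word A w = All (_∈ A) w

  closure : Pred 𝐀 0ℓ → Pred (List 𝐀) 0ℓ → Pred (List 𝐀) 0ℓ
  closure A T v = Word A v × ∃ λ w → w ∈ T × v ∝ w

  record Beh : Set₁ where
    constructor ⟨_,_⟩
    field
      alph : Pred 𝐀 0ℓ
      lang : Pred (List 𝐀) 0ℓ
  open Beh public

  record IsTrace (B : Beh) : Set where
    field
      lang⊆word     : lang B ⊆ Word (alph B)
      prefix-closed : ∀ u v → (u ++ v) ∈ lang B → u ∈ lang B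
      ε∈            : [] ∈ lang B

  _∥_ : Beh → Beh → Beh
  B₁ ∥ B₂ = ⟨ alph B₁ ∪ alph B₂ , T ⟩
    where
    T : Pred (List 𝐀) 0ℓ
    T w = Word (alph B₁ ∪ alph B₂) w ×
          Σ (Fin (length w) → Bool) λ I →
            select w I ∈ lang B₁ × select w (not ∘ I) ∈ lang B₂

  _≼_ : Beh → Beh → Set
  B₁ ≼ B₂ = (alph B₁ ⊆ alph B₂) × (lang B₁ ⊆ closure (alph B₁) (lang B₂))

module Submission where

-- Split a trace w of B₁ ∥ B₂ along its index set I into the
-- B₁-part l = (w_i)_{i∈I} and the B₂-part r = (w_i)_{i∉I}.  By B₂ ≼ B₃ the
-- part r is a subsequence of some trace r' of B₃.  The heart of the proof is
-- a purely combinatorial fact about interleavings: if w interleaves l and r,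
-- and r is a subsequence of r', then some w' interleaves l and r' and has w
-- as a subsequence (insert the extra letters of r' into w at the right
-- places).  Such a w' is a trace of B₁ ∥ B₃, and w ∝ w'.

open import Defs
open import Data.Bool using (Bool; true; false; not)
open import Data.Fin using (Fin; zero; suc)
open import Data.List using (List; []; _∷_; length)
open import Data.List.Relation.Unary.All using (All; []; _∷_)
open import Data.List.Relation.Binary.Sublist.Propositional
  using ([]; _∷ʳ_; _∷_) renaming (_⊆_ to _⊑_)
open import Data.List.Relation.Ternary.Interleaving.Propositional
  using (Interleaving; []; consˡ; consʳ)
import Data.Vec.Functional as Vec
open import Data.Product using (Σ; ∃; _×_; _,_)
open import Data.Sum using (inj₁; inj₂)
open import Function using (_∘_)
open import Relation.Unary using (Pred; _∈_; _⊆_; _∪_)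
open import Relation.Binary.PropositionalEquality using (_≡_; refl; cong; sym; subst)

module _ {𝐀 : Set} where

  select-interleaving : (w : List 𝐀) (I : Fin (length w) → Bool) →
                        Interleaving (select w I) (select w (not ∘ I)) w
  select-interleaving []      I = []
  select-interleaving (x ∷ w) I with I zero | select-interleaving w (I ∘ suc)
  ... | true  | sp = consˡ sp
  ... | false | sp = consʳ sp

  interleaving-select : ∀ {l r w : List 𝐀} → Interleaving l r w →
                        Σ (Fin (length w) → Bool) λ I →
                          select w I ≡ l × select w (not ∘ I) ≡ r
  interleaving-select [] = (λ ()) , refl , refl
  interleaving-select (consˡ sp) with interleaving-select sp
  ... | I , l≡ , r≡ = true Vec.∷ I , cong (_ ∷_) l≡ , r≡
  interleaving-select (consʳ sp) with interleaving-select sp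
  ... | I , l≡ , r≡ = false Vec.∷ I , l≡ , cong (_ ∷_) r≡

  select-⊑ : (w : List 𝐀) (I : Fin (length w) → Bool) → select w I ⊑ w
  select-⊑ []      I = []
  select-⊑ (x ∷ w) I with I zero
  ... | true  = refl ∷ select-⊑ w (I ∘ suc)
  ... | false = x ∷ʳ select-⊑ w (I ∘ suc)

  ∝⇒⊑ : ∀ {v w : List 𝐀} → v ∝ w → v ⊑ w
  ∝⇒⊑ {w = w} (I , refl) = select-⊑ w I

  ⊑⇒∝ : ∀ {v w : List 𝐀} → v ⊑ w → v ∝ w
  ⊑⇒∝ [] = (λ ()) , refl
  ⊑⇒∝ (y ∷ʳ τ) with ⊑⇒∝ τ
  ... | I , v≡ = false Vec.∷ I , v≡
  ⊑⇒∝ (refl ∷ τ) with ⊑⇒∝ τ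
  ... | I , v≡ = true Vec.∷ I , cong (_ ∷_) v≡

  -- Enlarging the right component of an interleaving to a super-sequence r'
  -- enlarges the interleaved word to a super-sequence interleaving l and r':
  -- the letters skipped by r ⊑ r' are inserted as right-hand letters.
  -- (Induction on the interleaving and the embedding, lexicographically.)
  extend-right : ∀ {l r r' w : List 𝐀} → Interleaving l r w → r ⊑ r' →
                 ∃ λ w' → Interleaving l r' w' × w ⊑ w'
  extend-right sp (y ∷ʳ τ) with extend-right sp τ
  ... | w' , sp' , w⊑w' = y ∷ w' , consʳ sp' , y ∷ʳ w⊑w'
  extend-right [] [] = [] , [] , []
  extend-right (consˡ sp) τ with extend-right sp τ
  ... | w' , sp' , w⊑w' = _ ∷ w' , consˡ sp' , refl ∷ w⊑w'
  extend-right (consʳ sp) (refl ∷ τ) with extend-right sp τ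
  ... | w' , sp' , w⊑w' = _ ∷ w' , consʳ sp' , refl ∷ w⊑w'

  interleaving-All : ∀ {p q} {P : Pred 𝐀 p} {Q : Pred 𝐀 q} {l r w : List 𝐀} →
                     Interleaving l r w → All P l → All Q r → All (P ∪ Q) w
  interleaving-All []         []       []       = []
  interleaving-All (consˡ sp) (p ∷ ps) qs       = inj₁ p ∷ interleaving-All sp ps qs
  interleaving-All (consʳ sp) ps       (q ∷ qs) = inj₂ q ∷ interleaving-All sp ps qs

mainTheorem1 : {𝐀 : Set} (B₁ B₂ B₃ : Beh {𝐀}) →
    IsTrace B₁ → IsTrace B₂ → IsTrace B₃ →
    B₂ ≼ B₃ → (B₁ ∥ B₂) ≼ (B₁ ∥ B₃)
mainTheorem1 B₁ B₂ B₃ t₁ _ t₃ (A₂⊆A₃ , T₂⊆T₃) = alphabet⊆ , language⊆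
  where
  alphabet⊆ : alph (B₁ ∥ B₂) ⊆ alph (B₁ ∥ B₃)
  alphabet⊆ (inj₁ a) = inj₁ a
  alphabet⊆ (inj₂ a) = inj₂ (A₂⊆A₃ a)

  language⊆ : lang (B₁ ∥ B₂) ⊆ closure (alph (B₁ ∥ B₂)) (lang (B₁ ∥ B₃))
  language⊆ {w} (w-word , I , l∈T₁ , r∈T₂) with T₂⊆T₃ r∈T₂
  ... | _ , r' , r'∈T₃ , r∝r' with extend-right (select-interleaving w I) (∝⇒⊑ r∝r')
  ... | w' , sp' , w⊑w' with interleaving-select sp'
  ... | I' , l≡ , r'≡ =
    w-word , w' ,
    ( interleaving-All sp' (IsTrace.lang⊆word t₁ l∈T₁) (IsTrace.lang⊆word t₃ r'∈T₃)
    , I' , subst (_∈ lang B₁) (sym l≡) l∈T₁ , subst (_∈ lang B₃) (sym r'≡) r'∈T₃ )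
    , ⊑⇒∝ w⊑w'
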